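{- Any weakly pointed symmetric monoidal closed category with an initial object $0$ is pointed (i.e. has a zero object). Moreover, $\perp_A=\perp_{I,A}$ for every object $A$, and the morphisms $\perp_{A,B}$ are zero morphisms.
   Context: A symmetric monoidal closed category (tensor $\otimes$, unit $I$, internal hom $\multimap$, left unitor $\lambda$) is \emph{weakly pointed} if it is equipped with a morphism $\perp_A:I\to A$ for each object $A$ such that $h\circ\perp_A=\perp_B$ for every morphism $h:A\to B$. For objects $A,B$ one then defines $\perp_{A,B}:A\to B$ as the composite $A\xrightarrow{\lambda_A^{ -1}}I\otimes A\xrightarrow{\mathbf{uncurry}(\perp_{A\multimap B})}B$. -}

module Defs where

open import Level using (Level; _⊔_) renaming (suc to lsuc)
open import Relation.Binary using (Rel; IsEquivalence)
open import Data.Product using (Σ; _×_; _,_)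

record Category (o ℓ e : Level) : Set (lsuc (o ⊔ ℓ ⊔ e)) where
  infix  4 _≈_ _⇒_
  infixr 9 _∘_
  field
    Obj : Set o
    _⇒_ : Obj → Obj → Set ℓ
    _≈_ : ∀ {A B} → Rel (A ⇒ B) e
    id  : ∀ {A} → A ⇒ A
    _∘_ : ∀ {A B C} → B ⇒ C → A ⇒ B → A ⇒ C
    equiv     : ∀ {A B} → IsEquivalence (_≈_ {A} {B})
    ∘-resp-≈  : ∀ {A B C} {f h : B ⇒ C} {g i : A ⇒ B} →
                f ≈ h → g ≈ i → f ∘ g ≈ h ∘ i
    assoc     : ∀ {A B C D} {f : A ⇒ B} {g : B ⇒ C} {h : C ⇒ D} →
                (h ∘ g) ∘ f ≈ h ∘ (g ∘ f)
    identityˡ : ∀ {A B} {f : A ⇒ B} → id ∘ f ≈ f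
    identityʳ : ∀ {A B} {f : A ⇒ B} → f ∘ id ≈ f

module _ {o ℓ e} (C : Category o ℓ e) where
  open Category C

  record IsInitial (X : Obj) : Set (o ⊔ ℓ ⊔ e) where
    field
      ! : ∀ A → X ⇒ A
      !-unique : ∀ {A} (f : X ⇒ A) → ! A ≈ f

  record IsTerminal (X : Obj) : Set (o ⊔ ℓ ⊔ e) where
    field
      ! : ∀ A → A ⇒ X
      !-unique : ∀ {A} (f : A ⇒ X) → ! A ≈ f

  IsZeroObject : Obj → Set (o ⊔ ℓ ⊔ e)
  IsZeroObject Z = IsInitial Z × IsTerminal Z

  Pointed : Set (o ⊔ ℓ ⊔ e)
  Pointed = Σ Obj IsZeroObject

  IsZeroMorphism : ∀ {A B} → A ⇒ B → Set (o ⊔ ℓ ⊔ e)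
  IsZeroMorphism {A} {B} f =
    Σ Obj λ Z → IsZeroObject Z × Σ (A ⇒ Z) λ g → Σ (Z ⇒ B) λ h → f ≈ h ∘ g

record SymmetricMonoidalClosedCategory (o ℓ e : Level) : Set (lsuc (o ⊔ ℓ ⊔ e)) where
  field
    category : Category o ℓ e
  open Category category
  infixr 10 _⊗₀_ _⊗₁_
  infixr 5 _⊸_
  field
    _⊗₀_ : Obj → Obj → Obj
    _⊗₁_ : ∀ {A B C D} → A ⇒ B → C ⇒ D → A ⊗₀ C ⇒ B ⊗₀ D
    ⊗-identity : ∀ {A B} → id {A} ⊗₁ id {B} ≈ id
    ⊗-homomorphism : ∀ {A B C D E F} {f : A ⇒ B} {g : B ⇒ C} {h : D ⇒ E} {k : E ⇒ F} →
                     (g ∘ f) ⊗₁ (k ∘ h) ≈ (g ⊗₁ k) ∘ (f ⊗₁ h)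
    ⊗-resp-≈ : ∀ {A B C D} {f f' : A ⇒ B} {g g' : C ⇒ D} →
               f ≈ f' → g ≈ g' → f ⊗₁ g ≈ f' ⊗₁ g'
    unit : Obj
    λ⇒ : ∀ {A} → unit ⊗₀ A ⇒ A
    λ⇐ : ∀ {A} → A ⇒ unit ⊗₀ A
    λ-isoˡ : ∀ {A} → λ⇐ ∘ λ⇒ ≈ id {unit ⊗₀ A}
    λ-isoʳ : ∀ {A} → λ⇒ ∘ λ⇐ ≈ id {A}
    λ-natural : ∀ {A B} {f : A ⇒ B} → f ∘ λ⇒ ≈ λ⇒ ∘ (id ⊗₁ f)
    ρ⇒ : ∀ {A} → A ⊗₀ unit ⇒ A
    ρ⇐ : ∀ {A} → A ⇒ A ⊗₀ unit
    ρ-isoˡ : ∀ {A} → ρ⇐ ∘ ρ⇒ ≈ id {A ⊗₀ unit}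
    ρ-isoʳ : ∀ {A} → ρ⇒ ∘ ρ⇐ ≈ id {A}
    ρ-natural : ∀ {A B} {f : A ⇒ B} → f ∘ ρ⇒ ≈ ρ⇒ ∘ (f ⊗₁ id)
    α⇒ : ∀ {A B C} → (A ⊗₀ B) ⊗₀ C ⇒ A ⊗₀ (B ⊗₀ C)
    α⇐ : ∀ {A B C} → A ⊗₀ (B ⊗₀ C) ⇒ (A ⊗₀ B) ⊗₀ C
    α-isoˡ : ∀ {A B C} → α⇐ ∘ α⇒ ≈ id {(A ⊗₀ B) ⊗₀ C}
    α-isoʳ : ∀ {A B C} → α⇒ ∘ α⇐ ≈ id {A ⊗₀ (B ⊗₀ C)}
    α-natural : ∀ {A B C D E F} {f : A ⇒ D} {g : B ⇒ E} {h : C ⇒ F} →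
                (f ⊗₁ (g ⊗₁ h)) ∘ α⇒ ≈ α⇒ ∘ ((f ⊗₁ g) ⊗₁ h)
    triangle : ∀ {A B} → (id {A} ⊗₁ λ⇒ {B}) ∘ α⇒ ≈ ρ⇒ ⊗₁ id
    pentagon : ∀ {A B C D} →
               (id {A} ⊗₁ α⇒ {B} {C} {D}) ∘ α⇒ ∘ (α⇒ ⊗₁ id) ≈ α⇒ ∘ α⇒
    σ : ∀ {A B} → A ⊗₀ B ⇒ B ⊗₀ A
    σ-natural : ∀ {A B C D} {f : A ⇒ B} {g : C ⇒ D} →
                (g ⊗₁ f) ∘ σ ≈ σ ∘ (f ⊗₁ g)
    σ-involutive : ∀ {A B} → σ ∘ σ ≈ id {A ⊗₀ B}
    hexagon : ∀ {A B C} →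
              (id {B} ⊗₁ σ {A} {C}) ∘ α⇒ ∘ (σ ⊗₁ id) ≈ α⇒ ∘ σ ∘ α⇒
    _⊸_ : Obj → Obj → Obj
    eval : ∀ {A B} → (A ⊸ B) ⊗₀ A ⇒ B
    curry : ∀ {X A B} → X ⊗₀ A ⇒ B → X ⇒ A ⊸ B
    eval-curry : ∀ {X A B} {f : X ⊗₀ A ⇒ B} → eval ∘ (curry f ⊗₁ id) ≈ f
    curry-unique : ∀ {X A B} {f : X ⊗₀ A ⇒ B} {g : X ⇒ A ⊸ B} →
                   eval ∘ (g ⊗₁ id) ≈ f → g ≈ curry f

  uncurry : ∀ {X A B} → X ⇒ A ⊸ B → X ⊗₀ A ⇒ B
  uncurry g = eval ∘ (g ⊗₁ id)

module _ {o ℓ e} (𝒞 : SymmetricMonoidalClosedCategory o ℓ e) where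
  open SymmetricMonoidalClosedCategory 𝒞
  open Category category

  record WeaklyPointed : Set (o ⊔ ℓ ⊔ e) where
    field
      ⊥ : ∀ A → unit ⇒ A
      ⊥-natural : ∀ {A B} (h : A ⇒ B) → h ∘ ⊥ A ≈ ⊥ B

    ⊥[_,_] : ∀ A B → A ⇒ B
    ⊥[ A , B ] = uncurry (⊥ (A ⊸ B)) ∘ λ⇐

module Submission where

-- Everything rests on one observation about a weakly pointed
-- symmetric monoidal closed category: for every g : X ⊗ Y → B,
--   uncurry ⊥_{Y⊸B} = g ∘ (⊥_X ⊗ id),
-- because ⊥_{Y⊸B} = curry g ∘ ⊥_X by naturality of ⊥.  From it we get
--   * ⊥_{A,-} is natural:  h ∘ ⊥_{A,B} = ⊥_{A,C};
--   * the map ⊥₂ = uncurry ⊥_{I⊸A} : I ⊗ I → A is invariant under scalars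
--     h : I → I acting on the right, hence (by symmetry) on the left, and
--     ⊥₂ = ⊥_A ∘ ρ; cancelling ρ gives ⊥_A ∘ h = ⊥_A for all scalars h,
--     and so ⊥_A = ⊥_{I,A}.
-- For an initial object 0, the last fact makes every point I → 0 equal to
-- ⊥_0 (as 0 is a retract of I), hence also every map I ⊗ I → 0 (as
-- I ⊗ I ≅ I).  Since 0 ⊗ A is initial (- ⊗ A is a left adjoint), every
-- f : A → 0 satisfies f ∘ λ = t ∘ (⊥_0 ⊗ id) with t : 0 ⊗ A → 0 unique,
-- so 0 is terminal; ⊥_{A,B} = ¡_B ∘ ⊥_{A,0} then factors through 0.

open import Defs
open import Level using (Level)
open import Data.Product using (Σ; _×_; _,_)
open import Relation.Binary using (Setoid; IsEquivalence)
import Relation.Binary.Reasoning.Setoid as SetoidReasoning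

module MonoidalClosedFacts {o ℓ e : Level} (𝒞 : SymmetricMonoidalClosedCategory o ℓ e) where
  open SymmetricMonoidalClosedCategory 𝒞 public
  open Category category public

  hom-setoid : ∀ A B → Setoid ℓ e
  hom-setoid A B = record { Carrier = A ⇒ B ; _≈_ = _≈_ ; isEquivalence = equiv }

  open module HomReasoning {A B} = SetoidReasoning (hom-setoid A B) public
  open module HomEquivalence {A B} = IsEquivalence (equiv {A} {B}) public
    using () renaming (refl to ≈-refl; sym to ≈-sym; trans to ≈-trans)

  infixr 4 _⟩∘⟨_
  _⟩∘⟨_ : ∀ {A B C} {f h : B ⇒ C} {g i : A ⇒ B} → f ≈ h → g ≈ i → f ∘ g ≈ h ∘ i
  _⟩∘⟨_ = ∘-resp-≈

  cancel-split-epi : ∀ {A B C} {r : A ⇒ B} {s : B ⇒ A} {f g : B ⇒ C} →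
                     r ∘ s ≈ id → f ∘ r ≈ g ∘ r → f ≈ g
  cancel-split-epi {r = r} {s} {f} {g} rs≈id fr≈gr = begin
    f              ≈⟨ ≈-sym identityʳ ⟩
    f ∘ id         ≈⟨ ≈-refl ⟩∘⟨ ≈-sym rs≈id ⟩
    f ∘ (r ∘ s)    ≈⟨ ≈-sym assoc ⟩
    (f ∘ r) ∘ s    ≈⟨ fr≈gr ⟩∘⟨ ≈-refl ⟩
    (g ∘ r) ∘ s    ≈⟨ assoc ⟩
    g ∘ (r ∘ s)    ≈⟨ ≈-refl ⟩∘⟨ rs≈id ⟩
    g ∘ id         ≈⟨ identityʳ ⟩
    g              ∎

  initial-unique : ∀ {Z B} → IsInitial category Z → (f g : Z ⇒ B) → f ≈ g
  initial-unique init f g = ≈-trans (≈-sym (!-unique f)) (!-unique g)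
    where open IsInitial init

  interchange : ∀ {A B C D} {f : A ⇒ B} {g : C ⇒ D} →
                (f ⊗₁ id) ∘ (id ⊗₁ g) ≈ (id ⊗₁ g) ∘ (f ⊗₁ id)
  interchange = begin
    (_ ⊗₁ id) ∘ (id ⊗₁ _)   ≈⟨ ≈-sym ⊗-homomorphism ⟩
    (_ ∘ id) ⊗₁ (id ∘ _)    ≈⟨ ⊗-resp-≈ (≈-trans identityʳ (≈-sym identityˡ))
                                        (≈-trans identityˡ (≈-sym identityʳ)) ⟩
    (id ∘ _) ⊗₁ (_ ∘ id)    ≈⟨ ⊗-homomorphism ⟩
    (id ⊗₁ _) ∘ (_ ⊗₁ id)   ∎

  uncurry-curry-∘ : ∀ {X Y A B} {f : X ⊗₀ A ⇒ B} {g : Y ⇒ X} →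
                    uncurry (curry f ∘ g) ≈ f ∘ (g ⊗₁ id)
  uncurry-curry-∘ {f = f} {g} = begin
    eval ∘ ((curry f ∘ g) ⊗₁ id)           ≈⟨ ≈-refl ⟩∘⟨ ⊗-resp-≈ ≈-refl (≈-sym identityˡ) ⟩
    eval ∘ ((curry f ∘ g) ⊗₁ (id ∘ id))    ≈⟨ ≈-refl ⟩∘⟨ ⊗-homomorphism ⟩
    eval ∘ ((curry f ⊗₁ id) ∘ (g ⊗₁ id))   ≈⟨ ≈-sym assoc ⟩
    (eval ∘ (curry f ⊗₁ id)) ∘ (g ⊗₁ id)   ≈⟨ eval-curry ⟩∘⟨ ≈-refl ⟩
    f ∘ (g ⊗₁ id)                          ∎

  -- Z ⊗ A is initial when Z is, since (- ⊗ A) is a left adjoint.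
  tensor-initial-unique : ∀ {Z A B} → IsInitial category Z → (g g' : Z ⊗₀ A ⇒ B) → g ≈ g'
  tensor-initial-unique init g g' = begin
    g                         ≈⟨ ≈-sym eval-curry ⟩
    eval ∘ (curry g ⊗₁ id)    ≈⟨ ≈-refl ⟩∘⟨ ⊗-resp-≈ (initial-unique init (curry g) (curry g')) ≈-refl ⟩
    eval ∘ (curry g' ⊗₁ id)   ≈⟨ eval-curry ⟩
    g'                        ∎

module WeaklyPointedFacts {o ℓ e : Level} (𝒞 : SymmetricMonoidalClosedCategory o ℓ e)
                          (wp : WeaklyPointed 𝒞) where
  open MonoidalClosedFacts 𝒞
  open WeaklyPointed wp

  -- The key observation: uncurry ⊥_{Y⊸B} factors through ⊥_X ⊗ id via any
  -- g : X ⊗ Y → B, because ⊥_{Y⊸B} = curry g ∘ ⊥_X.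
  uncurry-⊥-absorbs : ∀ {X Y B} (g : X ⊗₀ Y ⇒ B) → uncurry (⊥ (Y ⊸ B)) ≈ g ∘ (⊥ X ⊗₁ id)
  uncurry-⊥-absorbs {X} g = begin
    eval ∘ (⊥ _ ⊗₁ id)                ≈⟨ ≈-refl ⟩∘⟨ ⊗-resp-≈ (≈-sym (⊥-natural (curry g))) ≈-refl ⟩
    eval ∘ ((curry g ∘ ⊥ X) ⊗₁ id)    ≈⟨ uncurry-curry-∘ ⟩
    g ∘ (⊥ X ⊗₁ id)                   ∎

  ⊥[-,-]-natural : ∀ {A B C} (h : B ⇒ C) → h ∘ ⊥[ A , B ] ≈ ⊥[ A , C ]
  ⊥[-,-]-natural {A} {B} h = begin
    h ∘ (uncurry (⊥ (A ⊸ B)) ∘ λ⇐)     ≈⟨ ≈-sym assoc ⟩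
    (h ∘ uncurry (⊥ (A ⊸ B))) ∘ λ⇐     ≈⟨ ≈-sym assoc ⟩∘⟨ ≈-refl ⟩
    ((h ∘ eval) ∘ (⊥ _ ⊗₁ id)) ∘ λ⇐    ≈⟨ ≈-sym (uncurry-⊥-absorbs (h ∘ eval)) ⟩∘⟨ ≈-refl ⟩
    uncurry (⊥ (A ⊸ _)) ∘ λ⇐           ∎

  ⊥₂ : ∀ A → unit ⊗₀ unit ⇒ A
  ⊥₂ A = uncurry (⊥ (unit ⊸ A))

  ⊥₂-right-invariant : ∀ {A} (h : unit ⇒ unit) → ⊥₂ A ∘ (id ⊗₁ h) ≈ ⊥₂ A
  ⊥₂-right-invariant {A} h = ≈-sym (begin
    ⊥₂ A                                       ≈⟨ uncurry-⊥-absorbs (eval ∘ (id ⊗₁ h)) ⟩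
    (eval ∘ (id ⊗₁ h)) ∘ (⊥ _ ⊗₁ id)           ≈⟨ assoc ⟩
    eval ∘ ((id ⊗₁ h) ∘ (⊥ _ ⊗₁ id))           ≈⟨ ≈-refl ⟩∘⟨ ≈-sym interchange ⟩
    eval ∘ ((⊥ _ ⊗₁ id) ∘ (id ⊗₁ h))           ≈⟨ ≈-sym assoc ⟩
    ⊥₂ A ∘ (id ⊗₁ h)                           ∎)

  -- ⊥₂ is invariant under the symmetry: ⊥₂ = (⊥₂ ∘ σ) ∘ (⊥ ⊗ id) = ⊥₂ ∘ (id ⊗ ⊥) ∘ σ.
  ⊥₂-symmetric : ∀ {A} → ⊥₂ A ∘ σ ≈ ⊥₂ A
  ⊥₂-symmetric {A} = ≈-sym (begin
    ⊥₂ A                            ≈⟨ uncurry-⊥-absorbs (⊥₂ A ∘ σ) ⟩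
    (⊥₂ A ∘ σ) ∘ (⊥ unit ⊗₁ id)     ≈⟨ assoc ⟩
    ⊥₂ A ∘ (σ ∘ (⊥ unit ⊗₁ id))     ≈⟨ ≈-refl ⟩∘⟨ ≈-sym σ-natural ⟩
    ⊥₂ A ∘ ((id ⊗₁ ⊥ unit) ∘ σ)     ≈⟨ ≈-sym assoc ⟩
    (⊥₂ A ∘ (id ⊗₁ ⊥ unit)) ∘ σ     ≈⟨ ⊥₂-right-invariant (⊥ unit) ⟩∘⟨ ≈-refl ⟩
    ⊥₂ A ∘ σ                        ∎)

  ⊥₂-left-invariant : ∀ {A} (h : unit ⇒ unit) → ⊥₂ A ∘ (h ⊗₁ id) ≈ ⊥₂ A
  ⊥₂-left-invariant {A} h = begin
    ⊥₂ A ∘ (h ⊗₁ id)          ≈⟨ ≈-sym ⊥₂-symmetric ⟩∘⟨ ≈-refl ⟩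
    (⊥₂ A ∘ σ) ∘ (h ⊗₁ id)    ≈⟨ assoc ⟩
    ⊥₂ A ∘ (σ ∘ (h ⊗₁ id))    ≈⟨ ≈-refl ⟩∘⟨ ≈-sym σ-natural ⟩
    ⊥₂ A ∘ ((id ⊗₁ h) ∘ σ)    ≈⟨ ≈-sym assoc ⟩
    (⊥₂ A ∘ (id ⊗₁ h)) ∘ σ    ≈⟨ ⊥₂-right-invariant h ⟩∘⟨ ≈-refl ⟩
    ⊥₂ A ∘ σ                  ≈⟨ ⊥₂-symmetric ⟩
    ⊥₂ A                      ∎

  ⊥₂-via-ρ : ∀ {A} → ⊥₂ A ≈ ⊥ A ∘ ρ⇒
  ⊥₂-via-ρ {A} = begin
    ⊥₂ A                              ≈⟨ uncurry-⊥-absorbs (⊥ A ∘ ρ⇒) ⟩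
    (⊥ A ∘ ρ⇒) ∘ (⊥ unit ⊗₁ id)       ≈⟨ assoc ⟩
    ⊥ A ∘ (ρ⇒ ∘ (⊥ unit ⊗₁ id))       ≈⟨ ≈-refl ⟩∘⟨ ≈-sym ρ-natural ⟩
    ⊥ A ∘ (⊥ unit ∘ ρ⇒)               ≈⟨ ≈-sym assoc ⟩
    (⊥ A ∘ ⊥ unit) ∘ ρ⇒               ≈⟨ ⊥-natural (⊥ A) ⟩∘⟨ ≈-refl ⟩
    ⊥ A ∘ ρ⇒                          ∎

  ⊥-absorbs-scalars : ∀ {A} (h : unit ⇒ unit) → ⊥ A ∘ h ≈ ⊥ A
  ⊥-absorbs-scalars {A} h = cancel-split-epi ρ-isoʳ (begin
    (⊥ A ∘ h) ∘ ρ⇒             ≈⟨ assoc ⟩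
    ⊥ A ∘ (h ∘ ρ⇒)             ≈⟨ ≈-refl ⟩∘⟨ ρ-natural ⟩
    ⊥ A ∘ (ρ⇒ ∘ (h ⊗₁ id))     ≈⟨ ≈-sym assoc ⟩
    (⊥ A ∘ ρ⇒) ∘ (h ⊗₁ id)     ≈⟨ ≈-sym ⊥₂-via-ρ ⟩∘⟨ ≈-refl ⟩
    ⊥₂ A ∘ (h ⊗₁ id)           ≈⟨ ⊥₂-left-invariant h ⟩
    ⊥₂ A                       ≈⟨ ⊥₂-via-ρ ⟩
    ⊥ A ∘ ρ⇒                   ∎)

  ⊥≈⊥[unit,-] : ∀ A → ⊥ A ≈ ⊥[ unit , A ]
  ⊥≈⊥[unit,-] A = ≈-sym (begin
    ⊥₂ A ∘ λ⇐              ≈⟨ ⊥₂-via-ρ ⟩∘⟨ ≈-refl ⟩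
    (⊥ A ∘ ρ⇒) ∘ λ⇐        ≈⟨ assoc ⟩
    ⊥ A ∘ (ρ⇒ ∘ λ⇐)        ≈⟨ ⊥-absorbs-scalars (ρ⇒ ∘ λ⇐) ⟩
    ⊥ A                    ∎)

  module WithInitial {Z : Obj} (init : IsInitial category Z) where
    open IsInitial init renaming (! to ¡)

    -- Every map into Z factors through the point ⊥_Z, as Z is a retract of I.
    through-⊥ : ∀ {A} (f : A ⇒ Z) → f ≈ ⊥ Z ∘ (¡ unit ∘ f)
    through-⊥ f = begin
      f                      ≈⟨ ≈-sym identityˡ ⟩
      id ∘ f                 ≈⟨ initial-unique init id (⊥ Z ∘ ¡ unit) ⟩∘⟨ ≈-refl ⟩
      (⊥ Z ∘ ¡ unit) ∘ f     ≈⟨ assoc ⟩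
      ⊥ Z ∘ (¡ unit ∘ f)     ∎

    point-unique : (j : unit ⇒ Z) → j ≈ ⊥ Z
    point-unique j = ≈-trans (through-⊥ j) (⊥-absorbs-scalars (¡ unit ∘ j))

    -- Maps I ⊗ I → Z are unique as well, because I ⊗ I ≅ I.
    ⊥∘λ≈ρ∘⊥ : ⊥ Z ∘ λ⇒ ≈ ρ⇒ ∘ (⊥ Z ⊗₁ id)
    ⊥∘λ≈ρ∘⊥ = ≈-trans (cancel-split-epi ρ-isoˡ λ≈ρ) ρ-natural
      where
      λ≈ρ : (⊥ Z ∘ λ⇒) ∘ ρ⇐ ≈ (⊥ Z ∘ ρ⇒) ∘ ρ⇐
      λ≈ρ = ≈-trans (point-unique _) (≈-sym (point-unique _))

    factor-through-Z⊗ : ∀ {A} (f : A ⇒ Z) → Σ (Z ⊗₀ A ⇒ Z) λ t → f ∘ λ⇒ ≈ t ∘ (⊥ Z ⊗₁ id)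
    factor-through-Z⊗ f = ρ⇒ ∘ (id ⊗₁ k) , (begin
      f ∘ λ⇒                              ≈⟨ through-⊥ f ⟩∘⟨ ≈-refl ⟩
      (⊥ Z ∘ k) ∘ λ⇒                      ≈⟨ assoc ⟩
      ⊥ Z ∘ (k ∘ λ⇒)                      ≈⟨ ≈-refl ⟩∘⟨ λ-natural ⟩
      ⊥ Z ∘ (λ⇒ ∘ (id ⊗₁ k))              ≈⟨ ≈-sym assoc ⟩
      (⊥ Z ∘ λ⇒) ∘ (id ⊗₁ k)              ≈⟨ ⊥∘λ≈ρ∘⊥ ⟩∘⟨ ≈-refl ⟩
      (ρ⇒ ∘ (⊥ Z ⊗₁ id)) ∘ (id ⊗₁ k)      ≈⟨ assoc ⟩
      ρ⇒ ∘ ((⊥ Z ⊗₁ id) ∘ (id ⊗₁ k))      ≈⟨ ≈-refl ⟩∘⟨ interchange ⟩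
      ρ⇒ ∘ ((id ⊗₁ k) ∘ (⊥ Z ⊗₁ id))      ≈⟨ ≈-sym assoc ⟩
      (ρ⇒ ∘ (id ⊗₁ k)) ∘ (⊥ Z ⊗₁ id)      ∎)
      where k = ¡ unit ∘ f

    -- Maps into Z are unique: the factors t agree since Z ⊗ A is initial.
    into-Z-unique : ∀ {A} (f f' : A ⇒ Z) → f ≈ f'
    into-Z-unique f f' with factor-through-Z⊗ f | factor-through-Z⊗ f'
    ... | t , fλ≈t⊥ | t' , f'λ≈t'⊥ = cancel-split-epi λ-isoʳ (begin
      f ∘ λ⇒              ≈⟨ fλ≈t⊥ ⟩
      t ∘ (⊥ Z ⊗₁ id)     ≈⟨ tensor-initial-unique init t t' ⟩∘⟨ ≈-refl ⟩
      t' ∘ (⊥ Z ⊗₁ id)    ≈⟨ ≈-sym f'λ≈t'⊥ ⟩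
      f' ∘ λ⇒             ∎)

    zero-object : IsZeroObject category Z
    zero-object = init , record { ! = λ A → ⊥[ A , Z ] ; !-unique = into-Z-unique _ }

    ⊥[-,-]-zero : ∀ A B → IsZeroMorphism category ⊥[ A , B ]
    ⊥[-,-]-zero A B = Z , zero-object , ⊥[ A , Z ] , ¡ B , ≈-sym (⊥[-,-]-natural (¡ B))

mainTheorem5 : ∀ {o ℓ e : Level} (𝒞 : SymmetricMonoidalClosedCategory o ℓ e) →
    (wp : WeaklyPointed 𝒞) →
    (0C : Category.Obj (SymmetricMonoidalClosedCategory.category 𝒞)) →
    IsInitial (SymmetricMonoidalClosedCategory.category 𝒞) 0C →
    Pointed (SymmetricMonoidalClosedCategory.category 𝒞)
    × (∀ A → Category._≈_ (SymmetricMonoidalClosedCategory.category 𝒞)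
               (WeaklyPointed.⊥ wp A)
               (WeaklyPointed.⊥[_,_] wp (SymmetricMonoidalClosedCategory.unit 𝒞) A))
    × (∀ A B → IsZeroMorphism (SymmetricMonoidalClosedCategory.category 𝒞)
                 (WeaklyPointed.⊥[_,_] wp A B))
mainTheorem5 𝒞 wp Z init = (Z , zero-object) , ⊥≈⊥[unit,-] , ⊥[-,-]-zero
  where
  open WeaklyPointedFacts 𝒞 wp
  open WithInitial init
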